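{- Let $r$ and $k$ be integers with $3\le k\le r$, and let $n$ be a positive integer. Let $H$ be a linear $r$-uniform hypergraph on $n$ vertices which contains no copy of $C_{1,k}^r$ as a subhypergraph, and let $s$ be the number of vertices of $H$ of degree at least $(k-1)(r-1)+2$. Then $$|E(H)|\le \frac{\big((k-1)(r-1)+1\big)(n-s)}{r}.$$ Equivalently, $ex_r^{\mathrm{lin}}(n,C^r_{1,k}) \le \frac{((k-1)(r-1)+1)(n-s)}{r}$, where $s$ is the number of vertices of degree at least $(k-1)(r-1)+2$ in the hypergraph under consideration.
   Context: An $r$-uniform hypergraph ($r$-graph) is linear if every pair of vertices lies in at most one edge. The degree $d(v)$ of a vertex is the number of edges containing it. For $1\le k\le r$, the $k$-crown $C_{1,k}^r$ is the linear $r$-graph consisting of one base edge $e$ together with $k$ pairwise disjoint edges $e_1,\dots,e_k$, each intersecting $e$ in exactly one vertex, these $k$ vertices being distinct. For a family $\mathcal F$ of $r$-graphs, $ex_r^{\mathrm{lin}}(n,\mathcal F)$ denotes the maximum number of edges in an $\mathcal F$-free linear $r$-graph on $n$ vertices. -}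

module Defs where

open import Data.Nat using (ℕ; suc; _+_; _*_; _∸_; _≤_; _≤?_)
open import Data.Fin using (Fin)
open import Data.Fin.Subset using (Subset; _∈_; _∉_; _∩_; ∣_∣)
open import Data.Fin.Subset.Properties using (_∈?_)
open import Data.List using (List; length; filter; allFin)
open import Data.List.Membership.Propositional renaming (_∈_ to _∈ₗ_)
open import Data.List.Relation.Unary.Unique.Propositional using (Unique)
open import Data.Product using (Σ; _×_; ∃)
open import Relation.Binary.PropositionalEquality using (_≡_; _≢_)
open import Function.Definitions using (Injective)

record Hypergraph (n r : ℕ) : Set where
  field
    edges   : List (Subset n)
    unique  : Unique edges
    uniform : ∀ {e} → e ∈ₗ edges → ∣ e ∣ ≡ r
open Hypergraph public

numEdges : ∀ {n r} → Hypergraph n r → ℕ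
numEdges H = length (edges H)

Linear : ∀ {n r} → Hypergraph n r → Set
Linear H = ∀ {e f} → e ∈ₗ edges H → f ∈ₗ edges H → e ≢ f → ∣ e ∩ f ∣ ≤ 1

degree : ∀ {n r} → Hypergraph n r → Fin n → ℕ
degree H v = length (filter (λ e → v ∈? e) (edges H))

-- H contains a copy of the k-crown C^r_{1,k}: a base edge e and k pairwise
-- disjoint edges f 0, …, f (k-1), each meeting e in exactly one vertex g i,
-- the vertices g i being distinct.
ContainsCrown : ∀ {n r} → ℕ → Hypergraph n r → Set
ContainsCrown {n} k H =
  Σ (Subset n) λ e → e ∈ₗ edges H ×
  Σ (Fin k → Subset n) λ f → (∀ i → f i ∈ₗ edges H) ×
  (∀ i j → i ≢ j → ∣ f i ∩ f j ∣ ≡ 0) ×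
  Σ (Fin k → Fin n) λ g → Injective _≡_ _≡_ g ×
  (∀ i → g i ∈ e × g i ∈ f i × ∣ f i ∩ e ∣ ≡ 1)

numVerticesDegAtLeast : ∀ {n r} → Hypergraph n r → ℕ → ℕ
numVerticesDegAtLeast {n} H d = length (filter (λ v → d ≤? degree H v) (allFin n))

{-# OPTIONS --safe #-}
module Submission where

-- Discharging.  Give each vertex of degree d ≤ D = (k−1)(r−1)+1 the weight D/d and every
-- other vertex weight 0.  Summing over each edge the weights of its vertices counts every
-- vertex d times, so the total is at most D(n − s), and it suffices that each edge e
-- collects weight ≥ r.  If, for every j < k, at least k − j vertices of e had degree
-- ≥ j(r−1)+2, a k-crown on e could be built greedily, adding rays in order of increasing
-- level: by linearity, of the edges through a vertex w of e other than e itself at most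
-- j(r−1) meet the j rays already chosen (each meets them outside e), so degree ≥ j(r−1)+2
-- leaves a free one.  Hence at some level j < k at most k−j−1 vertices of e have degree
-- > c = j(r−1)+1; the remaining L ≥ r−k+j+1 vertices get weight ≥ D/c each, and r·c ≤ L·D.

open import Defs
open import Data.Bool.Base using (true; false; if_then_else_)
import Data.Bool.Properties as Bool
open import Data.Fin.Base using (Fin; zero; suc)
import Data.Fin.Properties as Fin
open import Data.Fin.Subset
  using (Subset; inside; outside; _∈_; _∉_; _⊆_; _∩_; _∪_; _─_; _-_; ⁅_⁆; ⊥; ∣_∣; Nonempty; Empty)
open import Data.Fin.Subset.Properties
open import Data.List.Base using (List; []; _∷_; length; filter; tabulate; allFin)
open import Data.List.Properties using (filter-some)
open import Data.List.Membership.Propositional using (find; lose) renaming (_∈_ to _∈ₗ_)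
open import Data.List.Membership.Propositional.Properties using (∈-filter⁻)
import Data.List.Relation.Unary.All as All
open import Data.List.Relation.Unary.AllPairs using (_∷_)
open import Data.List.Relation.Unary.Any using (here; there; any?)
open import Data.List.Relation.Unary.Unique.Propositional using (Unique)
import Data.List.Relation.Unary.Unique.Propositional.Properties as Unique
open import Data.Nat.Base using (ℕ; zero; suc; _+_; _*_; _∸_; _≤_; _<_; _!; z≤n; s≤s)
open import Data.Nat.DivMod using (_/_; m*[n/m]≡n; /-monoʳ-≤)
open import Data.Nat.Divisibility using (_∣_; ∣-trans; m∣m*n; m≤n⇒m!∣n!)
open import Data.Nat.Properties
open import Algebra.Properties.Semiring.Sum +-*-semiring
  using (sum; sum-syntax; sum-cong-≗; ∑-distrib-+; *-distribʳ-sum)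
open import Data.Nat.Tactic.RingSolver using (solve-∀)
open import Data.Product using (∃; _×_; _,_; uncurry)
open import Data.Sum using (inj₁; inj₂; [_,_]′)
open import Data.Vec.Base as Vec using ([]; _∷_; here; there)
import Data.Vec.Functional as Vector
open import Data.Vec.Properties using (≡-dec; lookup⇒[]=; []=⇒lookup; lookup∘tabulate)
open import Function.Base using (_∘_)
open import Function.Definitions using (Injective)
open import Relation.Binary.PropositionalEquality
open import Relation.Nullary using (¬_; Dec; yes; no; does; ¬?; _×-dec_)
open import Relation.Nullary.Decidable using (dec-true; decidable-stable)
open import Relation.Nullary.Negation using (contradiction)
open import Relation.Unary using (Pred; Decidable)

private
  variable
    n m : ℕ
    p q B S X : Subset n
    x y w : Fin n

_≟ₛ_ : (p q : Subset n) → Dec (p ≡ q)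
_≟ₛ_ = ≡-dec Bool._≟_

x∈p─q⇒x∉q : x ∈ p ─ q → x ∉ q
x∈p─q⇒x∉q {p = _ ∷ _} {q = outside ∷ _} here       ()
x∈p─q⇒x∉q {p = _ ∷ _} {q = _       ∷ _} (there x∈) (there x∈q) = x∈p─q⇒x∉q x∈ x∈q

x∈p⇒0<∣p∣ : x ∈ p → 0 < ∣ p ∣
x∈p⇒0<∣p∣ {x = x} x∈p = subst (_≤ _) (∣⁅x⁆∣≡1 x)
  (p⊆q⇒∣p∣≤∣q∣ λ y∈⁅x⁆ → subst (_∈ _) (sym (x∈⁅y⁆⇒x≡y x y∈⁅x⁆)) x∈p)

Empty⇒∣p∣≡0 : ∀ {n} {p : Subset n} → Empty p → ∣ p ∣ ≡ 0
Empty⇒∣p∣≡0 {n = n} empty = trans (cong ∣_∣ (Empty-unique empty)) (∣⊥∣≡0 n)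

0<∣p∣⇒Nonempty : 0 < ∣ p ∣ → Nonempty p
0<∣p∣⇒Nonempty {p = p} 0<∣p∣ with nonempty? p
... | yes nonempty = nonempty
... | no  empty    = contradiction (Empty⇒∣p∣≡0 empty) (n>0⇒n≢0 0<∣p∣)

∣p∣≤1⇒≡ : ∣ p ∣ ≤ 1 → x ∈ p → y ∈ p → x ≡ y
∣p∣≤1⇒≡ {x = x} {y = y} ∣p∣≤1 x∈p y∈p with x Fin.≟ y
... | yes x≡y = x≡y
... | no  x≢y = contradiction ∣p∣≤1 (<⇒≱ (≤-<-trans
  (x∈p⇒0<∣p∣ (x∈p∧x≢y⇒x∈p-y y∈p (x≢y ∘ sym))) (x∈p⇒∣p-x∣<∣p∣ x∈p)))

∣p∣≡∣p∩q∣+∣p─q∣ : ∀ (p q : Subset n) → ∣ p ∣ ≡ ∣ p ∩ q ∣ + ∣ p ─ q ∣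
∣p∣≡∣p∩q∣+∣p─q∣ []            []            = refl
∣p∣≡∣p∩q∣+∣p─q∣ (inside  ∷ p) (inside  ∷ q) = cong suc (∣p∣≡∣p∩q∣+∣p─q∣ p q)
∣p∣≡∣p∩q∣+∣p─q∣ (inside  ∷ p) (outside ∷ q) =
  trans (cong suc (∣p∣≡∣p∩q∣+∣p─q∣ p q)) (sym (+-suc _ _))
∣p∣≡∣p∩q∣+∣p─q∣ (outside ∷ p) (inside  ∷ q) = ∣p∣≡∣p∩q∣+∣p─q∣ p q
∣p∣≡∣p∩q∣+∣p─q∣ (outside ∷ p) (outside ∷ q) = ∣p∣≡∣p∩q∣+∣p─q∣ p q

∣p∪q∣≤∣p∣+∣q∣ : ∀ (p q : Subset n) → ∣ p ∪ q ∣ ≤ ∣ p ∣ + ∣ q ∣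
∣p∪q∣≤∣p∣+∣q∣ []            []            = z≤n
∣p∪q∣≤∣p∣+∣q∣ (inside  ∷ p) (s       ∷ q) =
  s≤s (≤-trans (∣p∪q∣≤∣p∣+∣q∣ p q) (+-monoʳ-≤ ∣ p ∣ (∣p∣≤∣x∷p∣ s q)))
∣p∪q∣≤∣p∣+∣q∣ (outside ∷ p) (inside  ∷ q) =
  ≤-trans (s≤s (∣p∪q∣≤∣p∣+∣q∣ p q)) (≤-reflexive (sym (+-suc _ _)))
∣p∪q∣≤∣p∣+∣q∣ (outside ∷ p) (outside ∷ q) = ∣p∪q∣≤∣p∣+∣q∣ p q

∣p∣≤1+∣p-x∣ : ∀ (p : Subset n) x → ∣ p ∣ ≤ 1 + ∣ p - x ∣
∣p∣≤1+∣p-x∣ p x = begin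
  ∣ p ∣                     ≡⟨ ∣p∣≡∣p∩q∣+∣p─q∣ p ⁅ x ⁆ ⟩
  ∣ p ∩ ⁅ x ⁆ ∣ + ∣ p - x ∣ ≤⟨ +-monoˡ-≤ _ (≤-trans (∣p∩q∣≤∣q∣ p ⁅ x ⁆) (≤-reflexive (∣⁅x⁆∣≡1 x))) ⟩
  1 + ∣ p - x ∣             ∎
  where open ≤-Reasoning

∣p∩q∣≤1+∣p-x∩q∣ : ∀ (p q : Subset n) x → ∣ p ∩ q ∣ ≤ 1 + ∣ (p - x) ∩ q ∣
∣p∩q∣≤1+∣p-x∩q∣ p q x = ≤-trans (∣p∣≤1+∣p-x∣ (p ∩ q) x) (+-monoʳ-≤ 1 (p⊆q⇒∣p∣≤∣q∣ p∩q-x⊆p-x∩q))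
  where
  p∩q-x⊆p-x∩q : (p ∩ q) - x ⊆ (p - x) ∩ q
  p∩q-x⊆p-x∩q y∈ =
    let y∈p , y∈q = x∈p∩q⁻ p q (p─q⊆p _ _ y∈)
    in  x∈p∩q⁺ (x∈p∧x∉q⇒x∈p─q y∈p (x∈p─q⇒x∉q y∈) , y∈q)

1<∣p∣⇒∃≢ : 1 < ∣ p ∣ → ∀ x → ∃ λ y → y ∈ p × y ≢ x
1<∣p∣⇒∃≢ {p = p} 1<∣p∣ x =
  let y , y∈p-x = 0<∣p∣⇒Nonempty (≤-pred (≤-trans 1<∣p∣ (∣p∣≤1+∣p-x∣ p x)))
  in  y , p─q⊆p p ⁅ x ⁆ y∈p-x , x∉⁅y⁆⇒x≢y (x∈p─q⇒x∉q y∈p-x)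

length≤∣∣ : ∀ {L : List (Subset n)} → Unique L →
  (∀ {f} → f ∈ₗ L → Nonempty (S ∩ f)) →
  (∀ {f g x} → f ∈ₗ L → g ∈ₗ L → x ∈ S → x ∈ f → x ∈ g → f ≡ g) →
  length L ≤ ∣ S ∣
length≤∣∣ {L = []} _ _ _ = z≤n
length≤∣∣ {S = S} {L = f ∷ L} (f∉L ∷ unique) meets once = begin-strict
  length L   ≤⟨ length≤∣∣ unique meets′ once′ ⟩
  ∣ S ─ f ∣  <⟨ p∩q≢∅⇒∣p─q∣<∣p∣ S f (meets (here refl)) ⟩
  ∣ S ∣      ∎
  where
  open ≤-Reasoning
  meets′ : ∀ {g} → g ∈ₗ L → Nonempty ((S ─ f) ∩ g)
  meets′ g∈L =
    let x , x∈S∩g = meets (there g∈L)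
        x∈S , x∈g = x∈p∩q⁻ S _ x∈S∩g
        x∉f x∈f   = All.lookup f∉L g∈L (once (here refl) (there g∈L) x∈S x∈f x∈g)
    in  x , x∈p∩q⁺ (x∈p∧x∉q⇒x∈p─q x∈S x∉f , x∈g)
  once′ : ∀ {g h x} → g ∈ₗ L → h ∈ₗ L → x ∈ S ─ f → x ∈ g → x ∈ h → g ≡ h
  once′ g∈L h∈L x∈S─f = once (there g∈L) (there h∈L) (p─q⊆p S f x∈S─f)

select : ∀ {ℓ} {P : Pred (Fin n) ℓ} → Decidable P → Subset n
select P? = Vec.tabulate (does ∘ P?)

module _ {ℓ} {P : Pred (Fin n) ℓ} (P? : Decidable P) where

  ∈-select⁺ : P x → x ∈ select P?
  ∈-select⁺ {x = x} px = lookup⇒[]= x _ (trans (lookup∘tabulate _ x) (dec-true (P? x) px))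

  ∈-select⁻ : x ∈ select P? → P x
  ∈-select⁻ {x = x} x∈ with P? x | trans (sym (lookup∘tabulate (does ∘ P?) x)) ([]=⇒lookup x∈)
  ... | yes px | _  = px
  ... | no  _  | ()

𝟙 : ∀ {a} {A : Set a} → Dec A → ℕ
𝟙 a? = if does a? then 1 else 0

𝟙≡1 : ∀ {a} {A : Set a} (a? : Dec A) → A → 𝟙 a? ≡ 1
𝟙≡1 a? a rewrite dec-true a? a = refl

∑-mono-≤ : ∀ {n} {f g : Fin n → ℕ} → (∀ i → f i ≤ g i) → sum f ≤ sum g
∑-mono-≤ {zero}  f≤g = z≤n
∑-mono-≤ {suc n} f≤g = +-mono-≤ (f≤g zero) (∑-mono-≤ (f≤g ∘ suc))

∣p∣≡∑𝟙 : ∀ (p : Subset n) → ∣ p ∣ ≡ ∑[ x < n ] 𝟙 (x ∈? p)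
∣p∣≡∑𝟙 []            = refl
∣p∣≡∑𝟙 (inside  ∷ p) = cong suc (∣p∣≡∑𝟙 p)
∣p∣≡∑𝟙 (outside ∷ p) = ∣p∣≡∑𝟙 p

module _ {a ℓ} {A : Set a} {P : Pred A ℓ} (P? : Decidable P) where

  length-filter+∑𝟙¬ : ∀ {n} (f : Fin n → A) →
    length (filter P? (tabulate f)) + ∑[ i < n ] 𝟙 (¬? (P? (f i))) ≡ n
  length-filter+∑𝟙¬ {zero}  f = refl
  length-filter+∑𝟙¬ {suc n} f with does (P? (f zero))
  ... | true  = cong suc (length-filter+∑𝟙¬ (f ∘ suc))
  ... | false = trans (+-suc _ _) (cong suc (length-filter+∑𝟙¬ (f ∘ suc)))

∑𝟙¬≡n∸length-filter : ∀ {ℓ} {P : Pred (Fin n) ℓ} (P? : Decidable P) →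
  ∑[ i < n ] 𝟙 (¬? (P? i)) ≡ n ∸ length (filter P? (allFin n))
∑𝟙¬≡n∸length-filter P? =
  trans (sym (m+n∸m≡n (length (filter P? (allFin _))) _))
        (cong (_∸ length (filter P? (allFin _))) (length-filter+∑𝟙¬ P? (λ i → i)))

length-filter-∷ : ∀ (f : Subset n) L x →
  length (filter (x ∈?_) (f ∷ L)) ≡ 𝟙 (x ∈? f) + length (filter (x ∈?_) L)
length-filter-∷ f L x with does (x ∈? f)
... | true  = refl
... | false = refl

length*≤∑-incidences : ∀ {c} (ω : Fin n → ℕ) (L : List (Subset n)) →
  (∀ {f} → f ∈ₗ L → c ≤ ∑[ x < n ] (𝟙 (x ∈? f) * ω x)) →
  length L * c ≤ ∑[ x < n ] (length (filter (x ∈?_) L) * ω x)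
length*≤∑-incidences ω []      _     = z≤n
length*≤∑-incidences {n = n} {c} ω (f ∷ L) bound = begin
  c + length L * c
    ≤⟨ +-mono-≤ (bound (here refl)) (length*≤∑-incidences ω L (bound ∘ there)) ⟩
  ∑[ x < n ] (𝟙 (x ∈? f) * ω x) + ∑[ x < n ] (length (filter (x ∈?_) L) * ω x)
    ≡⟨ ∑-distrib-+ (λ x → 𝟙 (x ∈? f) * ω x) (λ x → length (filter (x ∈?_) L) * ω x) ⟨
  ∑[ x < n ] (𝟙 (x ∈? f) * ω x + length (filter (x ∈?_) L) * ω x)
    ≡⟨ sum-cong-≗ (λ x → trans (cong (_* ω x) (length-filter-∷ f L x))
                                (*-distribʳ-+ (ω x) (𝟙 (x ∈? f)) _)) ⟨
  ∑[ x < n ] (length (filter (x ∈?_) (f ∷ L)) * ω x) ∎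
  where open ≤-Reasoning

module LinearHypergraph {n r} (H : Hypergraph n r) (linear : Linear H) where

  shared-pair⇒≡ : ∀ {f g} → f ∈ₗ edges H → g ∈ₗ edges H → x ≢ y →
    x ∈ f → y ∈ f → x ∈ g → y ∈ g → f ≡ g
  shared-pair⇒≡ {f = f} {g} f∈E g∈E x≢y x∈f y∈f x∈g y∈g with f ≟ₛ g
  ... | yes f≡g = f≡g
  ... | no  f≢g = contradiction
    (∣p∣≤1⇒≡ (linear f∈E g∈E f≢g) (x∈p∩q⁺ (x∈f , x∈g)) (x∈p∩q⁺ (y∈f , y∈g))) x≢y

  degree≤∣∣ : w ∉ S → (∀ {f} → f ∈ₗ edges H → w ∈ f → Nonempty (S ∩ f)) →
    degree H w ≤ ∣ S ∣
  degree≤∣∣ {w = w} {S = S} w∉S meets =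
    length≤∣∣ (Unique.filter⁺ (w ∈?_) (unique H)) (uncurry meets ∘ star⁻) once
    where
    star⁻ = ∈-filter⁻ (w ∈?_)
    once : ∀ {f g x} → f ∈ₗ filter (w ∈?_) (edges H) → g ∈ₗ filter (w ∈?_) (edges H) →
      x ∈ S → x ∈ f → x ∈ g → f ≡ g
    once f∈ g∈ x∈S x∈f x∈g =
      let f∈E , w∈f = star⁻ f∈
          g∈E , w∈g = star⁻ g∈
      in  shared-pair⇒≡ f∈E g∈E (λ x≡w → w∉S (subst (_∈ S) x≡w x∈S)) x∈f w∈f x∈g w∈g

  high? : ∀ j v → Dec (2 + j * (r ∸ 1) ≤ degree H v)
  high? j v = 2 + j * (r ∸ 1) ≤? degree H v

  High : ℕ → Subset n
  High j = select (high? j)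

  module _ {e} (e∈E : e ∈ₗ edges H) where

    -- Rays of a partial crown on e; blocked collects their vertices outside e.
    record PendantFamily (X : Subset n) (m : ℕ) : Set where
      field
        base    : Fin m → Fin n
        pendant : Fin m → Subset n
        blocked : Subset n
        base∈X            : ∀ i → base i ∈ X
        base∈pendant      : ∀ i → base i ∈ pendant i
        pendant∈E         : ∀ i → pendant i ∈ₗ edges H
        ∣pendant∩e∣≡1     : ∀ i → ∣ pendant i ∩ e ∣ ≡ 1
        pendant-disjoint  : ∀ i j → i ≢ j → ∣ pendant i ∩ pendant j ∣ ≡ 0
        pendant─e⊆blocked : ∀ i → pendant i ─ e ⊆ blocked
        blocked∩e=∅       : ∀ {x} → x ∈ blocked → x ∉ e
        ∣blocked∣≤        : ∣ blocked ∣ ≤ m * (r ∸ 1)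

    no-pendants : PendantFamily X 0
    no-pendants = record
      { base = λ () ; pendant = λ () ; blocked = ⊥
      ; base∈X = λ () ; base∈pendant = λ () ; pendant∈E = λ () ; ∣pendant∩e∣≡1 = λ ()
      ; pendant-disjoint = λ () ; pendant─e⊆blocked = λ ()
      ; blocked∩e=∅ = λ x∈⊥ _ → ∉⊥ x∈⊥ ; ∣blocked∣≤ = ≤-reflexive (∣⊥∣≡0 n)
      }

    crown : ∀ {k} → PendantFamily e k → ContainsCrown k H
    crown F = e , e∈E , pendant , pendant∈E , pendant-disjoint , base , base-injective ,
              λ i → base∈X i , base∈pendant i , ∣pendant∩e∣≡1 i
      where
      open PendantFamily F
      base-injective : Injective _≡_ _≡_ base
      base-injective {i} {j} bᵢ≡bⱼ with i Fin.≟ j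
      ... | yes i≡j = i≡j
      ... | no  i≢j = contradiction (pendant-disjoint i j i≢j) (n>0⇒n≢0 (x∈p⇒0<∣p∣
        (x∈p∩q⁺ (base∈pendant i , subst (_∈ pendant j) (sym bᵢ≡bⱼ) (base∈pendant j)))))

    extend : ∀ {f} (F : PendantFamily (X - w) m) → w ∈ X → X ⊆ e →
      f ∈ₗ edges H → w ∈ f → f ≢ e → Empty (f ∩ PendantFamily.blocked F) →
      PendantFamily X (suc m)
    extend {X = X} {w = w} {m = m} {f = f} F w∈X X⊆e f∈E w∈f f≢e f∩blocked=∅ = record
      { base    = w Vector.∷ base
      ; pendant = f Vector.∷ pendant
      ; blocked = blocked ∪ (f ─ e)
      ; base∈X            = λ { zero → w∈X ; (suc i) → p─q⊆p X ⁅ w ⁆ (base∈X i) }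
      ; base∈pendant      = λ { zero → w∈f ; (suc i) → base∈pendant i }
      ; pendant∈E         = λ { zero → f∈E ; (suc i) → pendant∈E i }
      ; ∣pendant∩e∣≡1     = λ { zero → ∣f∩e∣≡1 ; (suc i) → ∣pendant∩e∣≡1 i }
      ; pendant-disjoint  = disjoint
      ; pendant─e⊆blocked = λ { zero → x∈p∪q⁺ ∘ inj₂ ; (suc i) → x∈p∪q⁺ ∘ inj₁ ∘ pendant─e⊆blocked i }
      ; blocked∩e=∅       = [ blocked∩e=∅ , x∈p─q⇒x∉q ]′ ∘ x∈p∪q⁻ blocked (f ─ e)
      ; ∣blocked∣≤        = ∣blocked∪f─e∣≤
      }
      where
      open PendantFamily F
      w∈f∩e = x∈p∩q⁺ (w∈f , X⊆e w∈X)
      ∣f∩e∣≤1 = linear f∈E e∈E f≢e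
      ∣f∩e∣≡1 = ≤-antisym ∣f∩e∣≤1 (x∈p⇒0<∣p∣ w∈f∩e)
      f∩pendant=∅ : ∀ i → Empty (f ∩ pendant i)
      f∩pendant=∅ i (x , x∈f∩Fᵢ) with x∈p∩q⁻ f (pendant i) x∈f∩Fᵢ | x ∈? e
      ... | x∈f , x∈Fᵢ | no  x∉e = f∩blocked=∅
        (x , x∈p∩q⁺ (x∈f , pendant─e⊆blocked i (x∈p∧x∉q⇒x∈p─q x∈Fᵢ x∉e)))
      ... | x∈f , x∈Fᵢ | yes x∈e = x∉⁅y⁆⇒x≢y (x∈p─q⇒x∉q (base∈X i)) (trans bᵢ≡x x≡w)
        where
        x≡w  = ∣p∣≤1⇒≡ ∣f∩e∣≤1 (x∈p∩q⁺ (x∈f , x∈e)) w∈f∩e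
        bᵢ≡x = ∣p∣≤1⇒≡ (≤-reflexive (∣pendant∩e∣≡1 i))
                 (x∈p∩q⁺ (base∈pendant i , X⊆e (p─q⊆p X ⁅ w ⁆ (base∈X i)))) (x∈p∩q⁺ (x∈Fᵢ , x∈e))
      disjoint : ∀ i j → i ≢ j → ∣ (f Vector.∷ pendant) i ∩ (f Vector.∷ pendant) j ∣ ≡ 0
      disjoint zero    zero    0≢0 = contradiction refl 0≢0
      disjoint zero    (suc j) _   = Empty⇒∣p∣≡0 (f∩pendant=∅ j)
      disjoint (suc i) zero    _   = trans (cong ∣_∣ (∩-comm (pendant i) f)) (Empty⇒∣p∣≡0 (f∩pendant=∅ i))
      disjoint (suc i) (suc j) i≢j = pendant-disjoint i j (i≢j ∘ cong suc)
      ∣f─e∣≤r∸1 : ∣ f ─ e ∣ ≤ r ∸ 1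
      ∣f─e∣≤r∸1 = <⇒≤pred (subst (∣ f ─ e ∣ <_) (uniform H f∈E) (p∩q≢∅⇒∣p─q∣<∣p∣ f e (w , w∈f∩e)))
      ∣blocked∪f─e∣≤ : ∣ blocked ∪ (f ─ e) ∣ ≤ suc m * (r ∸ 1)
      ∣blocked∪f─e∣≤ = begin
        ∣ blocked ∪ (f ─ e) ∣       ≤⟨ ∣p∪q∣≤∣p∣+∣q∣ blocked (f ─ e) ⟩
        ∣ blocked ∣ + ∣ f ─ e ∣     ≤⟨ +-mono-≤ ∣blocked∣≤ ∣f─e∣≤r∸1 ⟩
        m * (r ∸ 1) + (r ∸ 1)       ≡⟨ +-comm (m * (r ∸ 1)) (r ∸ 1) ⟩
        suc m * (r ∸ 1)             ∎
        where open ≤-Reasoning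

    module _ (1<r : 1 < r) where

      pendant-edge : w ∈ e → (∀ {x} → x ∈ B → x ∉ e) → 2 + ∣ B ∣ ≤ degree H w →
        ∃ λ f → f ∈ₗ edges H × w ∈ f × f ≢ e × Empty (f ∩ B)
      pendant-edge {w = w} {B = B} w∈e B∩e=∅ deg≥
        with any? (λ f → w ∈? f ×-dec ¬? (f ≟ₛ e) ×-dec ¬? (nonempty? (f ∩ B))) (edges H)
      ... | yes found = let f , f∈E , pendant = find found in f , f∈E , pendant
      -- Otherwise every edge through w meets B ∪ ⁅ y ⁆ for another vertex y of e (e itself at y).
      ... | no  none
        with 1<∣p∣⇒∃≢ (subst (1 <_) (sym (uniform H e∈E)) 1<r) w
      ... | y , y∈e , y≢w = contradiction (degree≤∣∣ w∉B′ meets) (<⇒≱ (<-≤-trans ∣B′∣<2+∣B∣ deg≥))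
        where
        B′ = B ∪ ⁅ y ⁆
        ∣B′∣<2+∣B∣ : ∣ B′ ∣ < 2 + ∣ B ∣
        ∣B′∣<2+∣B∣ = s≤s (≤-trans (∣p∪q∣≤∣p∣+∣q∣ B ⁅ y ⁆)
          (≤-reflexive (trans (cong (∣ B ∣ +_) (∣⁅x⁆∣≡1 y)) (+-comm ∣ B ∣ 1))))
        w∉B′ : w ∉ B′
        w∉B′ w∈B′ with x∈p∪q⁻ B ⁅ y ⁆ w∈B′
        ... | inj₁ w∈B   = B∩e=∅ w∈B w∈e
        ... | inj₂ w∈⁅y⁆ = y≢w (sym (x∈⁅y⁆⇒x≡y y w∈⁅y⁆))
        meets : ∀ {f} → f ∈ₗ edges H → w ∈ f → Nonempty (B′ ∩ f)
        meets {f} f∈E w∈f with f ≟ₛ e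
        ... | yes refl = y , x∈p∩q⁺ (x∈p∪q⁺ (inj₂ (x∈⁅x⁆ y)) , y∈e)
        ... | no  f≢e  =
          let x , x∈f∩B = decidable-stable (nonempty? (f ∩ B))
                            (λ f∩B=∅ → none (lose f∈E (w∈f , f≢e , f∩B=∅)))
              x∈f , x∈B = x∈p∩q⁻ f B x∈f∩B
          in  x , x∈p∩q⁺ (x∈p∪q⁺ (inj₁ x∈B) , x∈f)

      -- w gets its ray last, after the K rays on X - w have blocked at most K(r − 1) vertices.
      greedy : ∀ K {X} → X ⊆ e → (∀ {j} → j < K → K ≤ j + ∣ X ∩ High j ∣) → PendantFamily X K
      greedy zero    _   _    = no-pendants
      greedy (suc K) {X} X⊆e rich =
        let w , w∈X∩High = 0<∣p∣⇒Nonempty ∣X∩High∣>0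
            w∈X , w∈High = x∈p∩q⁻ X (High K) w∈X∩High
            F = greedy K (⊆-trans (p─q⊆p X ⁅ w ⁆) X⊆e) (rich′ w)
            open PendantFamily F
            f , f∈E , w∈f , f≢e , f∩blocked=∅ = pendant-edge (X⊆e w∈X) blocked∩e=∅
              (≤-trans (+-monoʳ-≤ 2 ∣blocked∣≤) (∈-select⁻ (high? K) w∈High))
        in  extend F w∈X X⊆e f∈E w∈f f≢e f∩blocked=∅
        where
        ∣X∩High∣>0 : 0 < ∣ X ∩ High K ∣
        ∣X∩High∣>0 = +-cancelˡ-≤ K 1 _ (subst (_≤ K + ∣ X ∩ High K ∣) (+-comm 1 K) (rich ≤-refl))
        rich′ : ∀ w {j} → j < K → K ≤ j + ∣ (X - w) ∩ High j ∣
        rich′ w {j} j<K = ≤-pred (begin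
          suc K                            ≤⟨ rich (m<n⇒m<1+n j<K) ⟩
          j + ∣ X ∩ High j ∣                ≤⟨ +-monoʳ-≤ j (∣p∩q∣≤1+∣p-x∩q∣ X (High j) w) ⟩
          j + suc ∣ (X - w) ∩ High j ∣      ≡⟨ +-suc j _ ⟩
          suc (j + ∣ (X - w) ∩ High j ∣)    ∎)
          where open ≤-Reasoning

r*[1+ja]≤L*[1+[j+h]a] : ∀ {r L h j a} → r ≤ h + L → suc j ≤ L → 1 ≤ a →
  r * suc (j * a) ≤ L * suc ((j + h) * a)
r*[1+ja]≤L*[1+[j+h]a] {r} {L} {h} {j} {a} r≤h+L j<L 1≤a = begin
  r * c                 ≤⟨ *-monoˡ-≤ c r≤h+L ⟩
  (h + L) * c           ≡⟨ *-distribʳ-+ c h L ⟩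
  h * c + L * c         ≤⟨ +-monoˡ-≤ (L * c) (*-monoʳ-≤ h c≤L*a) ⟩
  h * (L * a) + L * c   ≡⟨ regroup h L j a ⟩
  L * suc ((j + h) * a) ∎
  where
  open ≤-Reasoning
  c = suc (j * a)
  c≤L*a : c ≤ L * a
  c≤L*a = ≤-trans (+-monoˡ-≤ (j * a) 1≤a) (*-monoˡ-≤ a j<L)
  regroup : ∀ h L j a → h * (L * a) + L * suc (j * a) ≡ L * suc ((j + h) * a)
  regroup = solve-∀

module Weight (D : ℕ) where

  -- Scaled by D!, a vertex of degree d ≤ D receives D / d; degree 0 gets 0 (no division by zero).
  weight : ℕ → ℕ
  weight zero      = 0
  weight d@(suc _) = 𝟙 (¬? (suc D ≤? d)) * (D * (D ! / d))

  *-weight≤ : ∀ d → d * weight d ≤ 𝟙 (¬? (suc D ≤? d)) * (D * D !)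
  *-weight≤ zero    = z≤n
  *-weight≤ (suc d) = by-cases (suc D ≤? suc d)
    where
    by-cases : (D<d? : Dec (suc D ≤ suc d)) →
      suc d * (𝟙 (¬? D<d?) * (D * (D ! / suc d))) ≤ 𝟙 (¬? D<d?) * (D * D !)
    by-cases (yes _)   = ≤-reflexive (*-zeroʳ (suc d))
    by-cases (no  D≮d) = ≤-reflexive (begin
      suc d * (1 * (D * (D ! / suc d))) ≡⟨ cong (suc d *_) (*-identityˡ _) ⟩
      suc d * (D * (D ! / suc d))       ≡⟨ x*[y*z]≡y*[x*z] (suc d) D (D ! / suc d) ⟩
      D * (suc d * (D ! / suc d))       ≡⟨ cong (D *_) (m*[n/m]≡n (∣-trans (m∣m*n (d !)) (m≤n⇒m!∣n! d≤D))) ⟩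
      D * D !                           ≡⟨ *-identityˡ (D * D !) ⟨
      1 * (D * D !)                     ∎)
      where
      open ≡-Reasoning
      d≤D = ≤-pred (≰⇒> D≮d)
      x*[y*z]≡y*[x*z] : ∀ x y z → x * (y * z) ≡ y * (x * z)
      x*[y*z]≡y*[x*z] = solve-∀

  weight-antitone : ∀ {c d} → 0 < d → d ≤ suc c → suc c ≤ D → D * (D ! / suc c) ≤ weight d
  weight-antitone {c} {suc d} _ d≤c c≤D = by-cases (suc D ≤? suc d)
    where
    by-cases : (D<d? : Dec (suc D ≤ suc d)) →
      D * (D ! / suc c) ≤ 𝟙 (¬? D<d?) * (D * (D ! / suc d))
    by-cases (yes D<d) = contradiction (≤-trans D<d (≤-trans d≤c c≤D)) (<-irrefl refl)
    by-cases (no  _)   = ≤-trans (*-monoʳ-≤ D (/-monoʳ-≤ (D !) d≤c)) (≤-reflexive (sym (*-identityˡ _)))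

module CrownFree {r k n} (H : Hypergraph n r) (linear : Linear H)
  (3≤k : 3 ≤ k) (k≤r : k ≤ r) (crown-free : ¬ ContainsCrown k H) where

  open LinearHypergraph H linear

  a D : ℕ
  a = r ∸ 1
  D = suc ((k ∸ 1) * a)
  open Weight D

  1<r : 1 < r
  1<r = ≤-trans (s≤s (s≤s z≤n)) (≤-trans 3≤k k≤r)

  sparse-level : ∀ {e} → e ∈ₗ edges H → ∃ λ j → j < k × j + ∣ e ∩ High j ∣ < k
  sparse-level {e} e∈E with anyUpTo? (λ j → ¬? (k ≤? j + ∣ e ∩ High j ∣)) k
  ... | yes (j , j<k , k≰) = j , j<k , ≰⇒> k≰
  ... | no  none           = contradiction (crown e∈E (greedy e∈E 1<r k ⊆-refl rich)) crown-free
    where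
    rich : ∀ {j} → j < k → k ≤ j + ∣ e ∩ High j ∣
    rich j<k = decidable-stable (k ≤? _) (λ k≰ → none (_ , j<k , k≰))

  low-vertex-weight : ∀ {e j v} → e ∈ₗ edges H → j < k → v ∈ e → v ∉ High j →
    D * (D ! / suc (j * a)) ≤ weight (degree H v)
  low-vertex-weight {j = j} {v} e∈E j<k v∈e v∉High =
    weight-antitone (filter-some (v ∈?_) (lose e∈E v∈e)) deg≤c (s≤s (*-monoˡ-≤ a (<⇒≤pred j<k)))
    where
    deg≤c : degree H v ≤ suc (j * a)
    deg≤c = ≤-pred (≰⇒> (v∉High ∘ ∈-select⁺ (high? j)))

  r*D!≤∑weight : ∀ {e} → e ∈ₗ edges H → r * D ! ≤ ∑[ v < n ] (𝟙 (v ∈? e) * weight (degree H v))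
  r*D!≤∑weight {e} e∈E with sparse-level e∈E
  ... | j , j<k , sparse = begin
    r * D !                                         ≡⟨ cong (r *_) (m*[n/m]≡n c∣D!) ⟨
    r * (c * D!/c)                                  ≡⟨ *-assoc r c D!/c ⟨
    r * c * D!/c                                    ≤⟨ *-monoˡ-≤ D!/c r*c≤L*D ⟩
    L * D * D!/c                                    ≡⟨ *-assoc L D D!/c ⟩
    L * (D * D!/c)                                  ≡⟨ cong (_* (D * D!/c)) (∣p∣≡∑𝟙 (e ─ High j)) ⟩
    (∑[ v < n ] 𝟙 (v ∈? e ─ High j)) * (D * D!/c)   ≡⟨ *-distribʳ-sum (D * D!/c) (λ v → 𝟙 (v ∈? e ─ High j)) ⟩
    ∑[ v < n ] (𝟙 (v ∈? e ─ High j) * (D * D!/c))   ≤⟨ ∑-mono-≤ low-vertex ⟩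
    ∑[ v < n ] (𝟙 (v ∈? e) * weight (degree H v))   ∎
    where
    open ≤-Reasoning
    c = suc (j * a)
    D!/c = D ! / c
    h = ∣ e ∩ High j ∣
    L = ∣ e ─ High j ∣
    c∣D! : c ∣ D !
    c∣D! = ∣-trans (m∣m*n ((j * a) !)) (m≤n⇒m!∣n! (s≤s (*-monoˡ-≤ a (<⇒≤pred j<k))))
    r≡h+L : r ≡ h + L
    r≡h+L = trans (sym (uniform H e∈E)) (∣p∣≡∣p∩q∣+∣p─q∣ e (High j))
    j<L : suc j ≤ L
    j<L = +-cancelʳ-≤ h (suc j) L (≤-trans sparse (≤-trans k≤r (≤-reflexive (trans r≡h+L (+-comm h L)))))
    r*c≤L*D : r * c ≤ L * D
    r*c≤L*D = ≤-trans (r*[1+ja]≤L*[1+[j+h]a] (≤-reflexive r≡h+L) j<L (∸-monoˡ-≤ 1 1<r))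
                      (*-monoʳ-≤ L (s≤s (*-monoˡ-≤ a (<⇒≤pred sparse))))
    low-vertex : ∀ v → 𝟙 (v ∈? e ─ High j) * (D * D!/c) ≤ 𝟙 (v ∈? e) * weight (degree H v)
    low-vertex v with v ∈? e ─ High j
    ... | no  _        = z≤n
    ... | yes v∈e─High =
      let v∈e = p─q⊆p e (High j) v∈e─High in
      subst (λ t → 1 * (D * D!/c) ≤ t * weight (degree H v)) (sym (𝟙≡1 (v ∈? e) v∈e))
        (*-monoʳ-≤ 1 (low-vertex-weight e∈E j<k v∈e (x∈p─q⇒x∉q v∈e─High)))

  low : ℕ
  low = n ∸ numVerticesDegAtLeast H (suc D)

  ∣E∣*[r*D!]≤low*[D*D!] : numEdges H * (r * D !) ≤ low * (D * D !)
  ∣E∣*[r*D!]≤low*[D*D!] = begin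
    numEdges H * (r * D !)
      ≤⟨ length*≤∑-incidences (weight ∘ degree H) (edges H) r*D!≤∑weight ⟩
    ∑[ v < n ] (degree H v * weight (degree H v))
      ≤⟨ ∑-mono-≤ (λ v → *-weight≤ (degree H v)) ⟩
    ∑[ v < n ] (𝟙 (¬? (suc D ≤? degree H v)) * (D * D !))
      ≡⟨ *-distribʳ-sum (D * D !) (λ v → 𝟙 (¬? (suc D ≤? degree H v))) ⟨
    (∑[ v < n ] 𝟙 (¬? (suc D ≤? degree H v))) * (D * D !)
      ≡⟨ cong (_* (D * D !)) (∑𝟙¬≡n∸length-filter (λ v → suc D ≤? degree H v)) ⟩
    low * (D * D !) ∎
    where open ≤-Reasoning

  r*∣E∣≤D*low : r * numEdges H ≤ D * low
  r*∣E∣≤D*low = *-cancelʳ-≤ _ _ (D !) {{D !≢0}} (subst₂ _≤_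
    (x*[y*z]≡y*x*z (numEdges H) r (D !)) (x*[y*z]≡y*x*z low D (D !)) ∣E∣*[r*D!]≤low*[D*D!])
    where
    x*[y*z]≡y*x*z : ∀ x y z → x * (y * z) ≡ y * x * z
    x*[y*z]≡y*x*z = solve-∀

theorem5 : (r k n : ℕ) → 3 ≤ k → k ≤ r → 1 ≤ n →
    (H : Hypergraph n r) → Linear H → ¬ ContainsCrown k H →
    r * numEdges H
      ≤ ((k ∸ 1) * (r ∸ 1) + 1)
        * (n ∸ numVerticesDegAtLeast H ((k ∸ 1) * (r ∸ 1) + 2))
theorem5 r k n 3≤k k≤r _ H linear crown-free =
  subst₂ (λ D T → r * numEdges H ≤ D * (n ∸ numVerticesDegAtLeast H T))
    (+-comm 1 ((k ∸ 1) * (r ∸ 1))) (+-comm 2 ((k ∸ 1) * (r ∸ 1)))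
    (CrownFree.r*∣E∣≤D*low H linear 3≤k k≤r crown-free)
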